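{- Let $F=(\mu,\eta,\Delta,\epsilon)$ be a commutative Frobenius algebra in a prop. Then the cocommutative co-monoids $(\Delta',\epsilon')$ such that $(\mu,\eta,\Delta',\epsilon')$ is a Frobenius algebra are exactly the phase-shifted co-monoids $(\Delta\circ\varphi,\ \epsilon\circ\varphi^{ -1})$, where $\varphi$ ranges over the phases of $F$.
   Context: A prop is a strict symmetric monoidal category whose objects are the natural numbers with $n\otimes m=n+m$; $id:1\to1$ is the identity wire and $\sigma:2\to2$ the symmetry. A commutative monoid is $\mu:2\to1$, $\eta:0\to1$ with $\mu\circ(\mu\otimes id)=\mu\circ(id\otimes\mu)$, $\mu\circ(\eta\otimes id)=id=\mu\circ(id\otimes\eta)$, $\mu\circ\sigma=\mu$; a cocommutative comonoid $\Delta:1\to2$, $\epsilon:1\to0$ satisfies the dual equations. $(\mu,\eta,\Delta,\epsilon)$ is a Frobenius algebra if $(\mu\otimes id)\circ(id\otimes\Delta)=\Delta\circ\mu=(id\otimes\mu)\circ(\Delta\otimes id)$; it is commutative if the monoid is commutative and the comonoid cocommutative. A phase of $F$ is an invertible morphism $\varphi:1\to1$ with $\mu\circ(\varphi\otimes id)=\varphi\circ\mu$ (in a Frobenius algebra these coincide with the invertible $\varphi$ satisfying $(\varphi\otimes id)\circ\Delta=\Delta\circ\varphi$). -}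

module Defs where

open import Level using (Level; suc; _⊔_)
open import Data.Nat using (ℕ; _+_)
open import Data.Nat.Properties using (+-assoc; +-identityʳ)
open import Data.Product using (Σ; _×_; _,_)
open import Relation.Binary.PropositionalEquality using (_≡_; refl; sym; subst₂)
open import Relation.Binary.Structures using (IsEquivalence)

-- Since m + (n + p) and (m + n) + p are only
-- propositionally equal in Agda, strictness laws are stated with explicit
-- transport ("cast") along the arithmetic equalities.
record Prop (c ℓ : Level) : Set (suc (c ⊔ ℓ)) where
  infixr 9 _∘_
  infixr 10 _⊗_
  infix  4 _≈_
  field
    Hom   : ℕ → ℕ → Set c
    _≈_   : ∀ {m n} → Hom m n → Hom m n → Set ℓ
    ≈-equiv : ∀ {m n} → IsEquivalence (_≈_ {m} {n})
    id    : ∀ n → Hom n n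
    _∘_   : ∀ {l m n} → Hom m n → Hom l m → Hom l n
    _⊗_   : ∀ {m n p q} → Hom m n → Hom p q → Hom (m + p) (n + q)
    σ     : ∀ m n → Hom (m + n) (n + m)

  cast : ∀ {m m' n n'} → m ≡ m' → n ≡ n' → Hom m n → Hom m' n'
  cast p q f = subst₂ Hom p q f

  field
    ∘-cong   : ∀ {l m n} {f f' : Hom m n} {g g' : Hom l m} →
               f ≈ f' → g ≈ g' → f ∘ g ≈ f' ∘ g'
    identityˡ : ∀ {m n} (f : Hom m n) → id n ∘ f ≈ f
    identityʳ : ∀ {m n} (f : Hom m n) → f ∘ id m ≈ f
    assoc    : ∀ {k l m n} (f : Hom m n) (g : Hom l m) (h : Hom k l) →
               (f ∘ g) ∘ h ≈ f ∘ (g ∘ h)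
    ⊗-cong   : ∀ {m n p q} {f f' : Hom m n} {g g' : Hom p q} →
               f ≈ f' → g ≈ g' → f ⊗ g ≈ f' ⊗ g'
    ⊗-id     : ∀ m n → id m ⊗ id n ≈ id (m + n)
    interchange : ∀ {a b c' d e f} (f₁ : Hom b c') (g₁ : Hom a b)
                    (f₂ : Hom e f) (g₂ : Hom d e) →
                  (f₁ ∘ g₁) ⊗ (f₂ ∘ g₂) ≈ (f₁ ⊗ f₂) ∘ (g₁ ⊗ g₂)
    ⊗-unitˡ  : ∀ {m n} (f : Hom m n) → id 0 ⊗ f ≈ f
    ⊗-unitʳ  : ∀ {m n} (f : Hom m n) →
               cast (+-identityʳ m) (+-identityʳ n) (f ⊗ id 0) ≈ f
    ⊗-assoc  : ∀ {m n p q r s} (f : Hom m n) (g : Hom p q) (h : Hom r s) →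
               cast (+-assoc m p r) (+-assoc n q s) ((f ⊗ g) ⊗ h) ≈ f ⊗ (g ⊗ h)
    σ-natural : ∀ {m n p q} (f : Hom m n) (g : Hom p q) →
                σ n q ∘ (f ⊗ g) ≈ (g ⊗ f) ∘ σ m p
    σ-involutive : ∀ m n → σ n m ∘ σ m n ≈ id (m + n)
    σ-unit   : ∀ m → cast (+-identityʳ m) refl (σ m 0) ≈ id m
    σ-hexagon : ∀ m n p →
                σ m (n + p) ≈
                  cast (sym (+-assoc n m p)) (sym (+-assoc n p m)) (id n ⊗ σ m p)
                  ∘ cast (+-assoc m n p) refl (σ m n ⊗ id p)

  wire : Hom 1 1
  wire = id 1

  swap : Hom 2 2
  swap = σ 1 1

module _ {c ℓ : Level} (P : Prop c ℓ) where
  open Prop P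

  record IsCommMonoid (μ : Hom 2 1) (η : Hom 0 1) : Set ℓ where
    field
      μ-assoc : μ ∘ (μ ⊗ wire) ≈ μ ∘ (wire ⊗ μ)
      μ-unitˡ : μ ∘ (η ⊗ wire) ≈ wire
      μ-unitʳ : μ ∘ (wire ⊗ η) ≈ wire
      μ-comm  : μ ∘ swap ≈ μ

  record IsCocommComonoid (Δ : Hom 1 2) (ε : Hom 1 0) : Set ℓ where
    field
      Δ-coassoc : (Δ ⊗ wire) ∘ Δ ≈ (wire ⊗ Δ) ∘ Δ
      Δ-counitˡ : (ε ⊗ wire) ∘ Δ ≈ wire
      Δ-counitʳ : (wire ⊗ ε) ∘ Δ ≈ wire
      Δ-cocomm  : swap ∘ Δ ≈ Δ

  record IsFrobeniusLaw (μ : Hom 2 1) (Δ : Hom 1 2) : Set ℓ where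
    field
      frobˡ : (μ ⊗ wire) ∘ (wire ⊗ Δ) ≈ Δ ∘ μ
      frobʳ : (wire ⊗ μ) ∘ (Δ ⊗ wire) ≈ Δ ∘ μ

  record IsMonoid (μ : Hom 2 1) (η : Hom 0 1) : Set ℓ where
    field
      μ-assoc : μ ∘ (μ ⊗ wire) ≈ μ ∘ (wire ⊗ μ)
      μ-unitˡ : μ ∘ (η ⊗ wire) ≈ wire
      μ-unitʳ : μ ∘ (wire ⊗ η) ≈ wire

  record IsComonoid (Δ : Hom 1 2) (ε : Hom 1 0) : Set ℓ where
    field
      Δ-coassoc : (Δ ⊗ wire) ∘ Δ ≈ (wire ⊗ Δ) ∘ Δ
      Δ-counitˡ : (ε ⊗ wire) ∘ Δ ≈ wire
      Δ-counitʳ : (wire ⊗ ε) ∘ Δ ≈ wire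

  record IsFrobenius (μ : Hom 2 1) (η : Hom 0 1) (Δ : Hom 1 2) (ε : Hom 1 0) : Set ℓ where
    field
      isMonoid   : IsMonoid μ η
      isComonoid : IsComonoid Δ ε
      frobenius  : IsFrobeniusLaw μ Δ

  record IsCommFrobenius (μ : Hom 2 1) (η : Hom 0 1) (Δ : Hom 1 2) (ε : Hom 1 0) : Set ℓ where
    field
      isFrobenius     : IsFrobenius μ η Δ ε
      isCommMonoid    : IsCommMonoid μ η
      isCocommComonoid : IsCocommComonoid Δ ε

  IsInverse : Hom 1 1 → Hom 1 1 → Set ℓ
  IsInverse φ ψ = (φ ∘ ψ ≈ wire) × (ψ ∘ φ ≈ wire)

  IsPhase : (μ : Hom 2 1) → Hom 1 1 → Hom 1 1 → Set ℓ
  IsPhase μ φ ψ = IsInverse φ ψ × (μ ∘ (φ ⊗ wire) ≈ φ ∘ μ)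

-- For two comonoids (Δ₁, ε₁), (Δ₂, ε₂) that are Frobenius with the same unital μ, the
-- comparison map φ = (ε₁ ⊗ id) ∘ Δ₂ is a phase: the Frobenius law for Δ₂ lets φ slide
-- through μ.  Since every Frobenius comultiplication is recovered from μ and Δ ∘ η, Δ₂ and
-- Δ₁ interchange, (id ⊗ Δ₂) ∘ Δ₁ = (Δ₁ ⊗ id) ∘ Δ₂, and applying counits to this gives
-- Δ₂ = Δ₁ ∘ φ; the comparison in the other direction is the inverse of φ and shifts ε₁ to ε₂.
-- Conversely, a phase commutes with Δ on either leg (by commutativity), which is all that is
-- needed to check that (Δ ∘ φ, ε ∘ φ⁻¹) is again a cocommutative Frobenius comonoid.
module Submission where

open import Defs
open import Level using (Level; _⊔_)
open import Data.Nat using (ℕ)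
open import Data.Nat.Properties using (+-assoc)
open import Data.Product using (Σ; _×_; _,_)
open import Function.Bundles using (_⇔_; mk⇔)
open import Relation.Binary.Bundles using (Setoid)
open import Relation.Binary.Structures using (IsEquivalence)
import Relation.Binary.Reasoning.Setoid as SetoidReasoning

module FrobeniusPhases {c ℓ : Level} (P : Prop c ℓ) where
  open Prop P

  module ≈ {m n : ℕ} = IsEquivalence (≈-equiv {m} {n})

  homSetoid : ℕ → ℕ → Setoid c ℓ
  homSetoid m n = record { Carrier = Hom m n ; _≈_ = _≈_ ; isEquivalence = ≈-equiv }

  open module Reasoning {m n : ℕ} = SetoidReasoning (homSetoid m n)
    using (begin_; _∎; step-≈-⟩; step-≈-⟨)

  ∘-resp-≈ˡ : ∀ {l m n} {f f′ : Hom m n} {g : Hom l m} → f ≈ f′ → f ∘ g ≈ f′ ∘ g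
  ∘-resp-≈ˡ p = ∘-cong p ≈.refl

  ∘-resp-≈ʳ : ∀ {l m n} {f : Hom m n} {g g′ : Hom l m} → g ≈ g′ → f ∘ g ≈ f ∘ g′
  ∘-resp-≈ʳ p = ∘-cong ≈.refl p

  assocʳ : ∀ {k l m n} {f : Hom m n} {g : Hom l m} {h : Hom k l} → (f ∘ g) ∘ h ≈ f ∘ (g ∘ h)
  assocʳ = assoc _ _ _

  assocˡ : ∀ {k l m n} {f : Hom m n} {g : Hom l m} {h : Hom k l} → f ∘ (g ∘ h) ≈ (f ∘ g) ∘ h
  assocˡ = ≈.sym (assoc _ _ _)

  serialize₁₂ : ∀ {a b p q} (f : Hom a b) (g : Hom p q) → f ⊗ g ≈ (f ⊗ id q) ∘ (id a ⊗ g)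
  serialize₁₂ {a} {q = q} f g =
    ≈.trans (⊗-cong (≈.sym (identityʳ f)) (≈.sym (identityˡ g))) (interchange f (id a) (id q) g)

  serialize₂₁ : ∀ {a b p q} (f : Hom a b) (g : Hom p q) → f ⊗ g ≈ (id b ⊗ g) ∘ (f ⊗ id p)
  serialize₂₁ {b = b} {p} f g =
    ≈.trans (⊗-cong (≈.sym (identityˡ f)) (≈.sym (identityʳ g))) (interchange (id b) f g (id p))

  ⊗-commute : ∀ {a b p q} (f : Hom a b) (g : Hom p q) →
              (id b ⊗ g) ∘ (f ⊗ id p) ≈ (f ⊗ id q) ∘ (id a ⊗ g)
  ⊗-commute f g = ≈.trans (≈.sym (serialize₂₁ f g)) (serialize₁₂ f g)

  first-∘ : ∀ {l m n k} (f : Hom m n) (g : Hom l m) → (f ∘ g) ⊗ id k ≈ (f ⊗ id k) ∘ (g ⊗ id k)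
  first-∘ {k = k} f g = ≈.trans (⊗-cong ≈.refl (≈.sym (identityˡ (id k)))) (interchange f g (id k) (id k))

  second-∘ : ∀ {l m n k} (f : Hom m n) (g : Hom l m) → id k ⊗ (f ∘ g) ≈ (id k ⊗ f) ∘ (id k ⊗ g)
  second-∘ {k = k} f g = ≈.trans (⊗-cong (≈.sym (identityˡ (id k))) ≈.refl) (interchange (id k) (id k) f g)

  ⊗-wire-wire : ∀ {m n} (f : Hom m n) →
                cast (+-assoc m 1 1) (+-assoc n 1 1) ((f ⊗ wire) ⊗ wire) ≈ f ⊗ id 2
  ⊗-wire-wire f = ≈.trans (⊗-assoc f wire wire) (⊗-cong ≈.refl (⊗-id 1 1))

  wire-wire-⊗ : ∀ {p q} (g : Hom p q) → id 2 ⊗ g ≈ wire ⊗ (wire ⊗ g)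
  wire-wire-⊗ g = ≈.trans (⊗-cong (≈.sym (⊗-id 1 1)) ≈.refl) (⊗-assoc wire wire g)

  μ-phaseʳ : ∀ {μ : Hom 2 1} {φ : Hom 1 1} →
             μ ∘ swap ≈ μ → μ ∘ (φ ⊗ wire) ≈ φ ∘ μ → μ ∘ (wire ⊗ φ) ≈ φ ∘ μ
  μ-phaseʳ {μ} {φ} comm phase = begin
    μ ∘ (wire ⊗ φ)          ≈⟨ ∘-resp-≈ˡ comm ⟨
    (μ ∘ swap) ∘ (wire ⊗ φ) ≈⟨ assocʳ ⟩
    μ ∘ (swap ∘ (wire ⊗ φ)) ≈⟨ ∘-resp-≈ʳ (σ-natural wire φ) ⟩
    μ ∘ ((φ ⊗ wire) ∘ swap) ≈⟨ assocˡ ⟩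
    (μ ∘ (φ ⊗ wire)) ∘ swap ≈⟨ ∘-resp-≈ˡ phase ⟩
    (φ ∘ μ) ∘ swap          ≈⟨ assocʳ ⟩
    φ ∘ (μ ∘ swap)          ≈⟨ ∘-resp-≈ʳ comm ⟩
    φ ∘ μ                   ∎

  Δ-phaseʳ : ∀ {Δ : Hom 1 2} {φ : Hom 1 1} →
             swap ∘ Δ ≈ Δ → (φ ⊗ wire) ∘ Δ ≈ Δ ∘ φ → (wire ⊗ φ) ∘ Δ ≈ Δ ∘ φ
  Δ-phaseʳ {Δ} {φ} cocomm phase = begin
    (wire ⊗ φ) ∘ Δ          ≈⟨ ∘-resp-≈ʳ cocomm ⟨
    (wire ⊗ φ) ∘ (swap ∘ Δ) ≈⟨ assocˡ ⟩
    ((wire ⊗ φ) ∘ swap) ∘ Δ ≈⟨ ∘-resp-≈ˡ (σ-natural φ wire) ⟨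
    (swap ∘ (φ ⊗ wire)) ∘ Δ ≈⟨ assocʳ ⟩
    swap ∘ ((φ ⊗ wire) ∘ Δ) ≈⟨ ∘-resp-≈ʳ phase ⟩
    swap ∘ (Δ ∘ φ)          ≈⟨ assocˡ ⟩
    (swap ∘ Δ) ∘ φ          ≈⟨ ∘-resp-≈ˡ cocomm ⟩
    Δ ∘ φ                   ∎

  Δ-via-μ : ∀ {μ : Hom 2 1} {η : Hom 0 1} {Δ : Hom 1 2} →
            (μ ⊗ wire) ∘ (wire ⊗ Δ) ≈ Δ ∘ μ → μ ∘ (wire ⊗ η) ≈ wire →
            (μ ⊗ wire) ∘ (wire ⊗ (Δ ∘ η)) ≈ Δ
  Δ-via-μ {μ} {η} {Δ} frobˡ unitʳ = begin
    (μ ⊗ wire) ∘ (wire ⊗ (Δ ∘ η))          ≈⟨ ∘-resp-≈ʳ (second-∘ Δ η) ⟩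
    (μ ⊗ wire) ∘ ((wire ⊗ Δ) ∘ (wire ⊗ η)) ≈⟨ assocˡ ⟩
    ((μ ⊗ wire) ∘ (wire ⊗ Δ)) ∘ (wire ⊗ η) ≈⟨ ∘-resp-≈ˡ frobˡ ⟩
    (Δ ∘ μ) ∘ (wire ⊗ η)                   ≈⟨ assocʳ ⟩
    Δ ∘ (μ ∘ (wire ⊗ η))                   ≈⟨ ∘-resp-≈ʳ unitʳ ⟩
    Δ ∘ wire                               ≈⟨ identityʳ Δ ⟩
    Δ                                      ∎

  Δ-phaseˡ : ∀ {μ : Hom 2 1} {η : Hom 0 1} {Δ : Hom 1 2} {φ : Hom 1 1} →
             (μ ⊗ wire) ∘ (wire ⊗ Δ) ≈ Δ ∘ μ → μ ∘ (wire ⊗ η) ≈ wire →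
             μ ∘ (φ ⊗ wire) ≈ φ ∘ μ → (φ ⊗ wire) ∘ Δ ≈ Δ ∘ φ
  Δ-phaseˡ {μ} {η} {Δ} {φ} frobˡ unitʳ phase = begin
    (φ ⊗ wire) ∘ Δ                                         ≈⟨ ∘-resp-≈ʳ Δ≈ ⟨
    (φ ⊗ wire) ∘ ((μ ⊗ wire) ∘ (wire ⊗ Δη))                ≈⟨ assocˡ ⟩
    ((φ ⊗ wire) ∘ (μ ⊗ wire)) ∘ (wire ⊗ Δη)                ≈⟨ ∘-resp-≈ˡ (first-∘ φ μ) ⟨
    ((φ ∘ μ) ⊗ wire) ∘ (wire ⊗ Δη)                         ≈⟨ ∘-resp-≈ˡ (⊗-cong phase ≈.refl) ⟨
    ((μ ∘ (φ ⊗ wire)) ⊗ wire) ∘ (wire ⊗ Δη)                ≈⟨ ∘-resp-≈ˡ (first-∘ μ (φ ⊗ wire)) ⟩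
    ((μ ⊗ wire) ∘ ((φ ⊗ wire) ⊗ wire)) ∘ (wire ⊗ Δη)       ≈⟨ assocʳ ⟩
    (μ ⊗ wire) ∘ (((φ ⊗ wire) ⊗ wire) ∘ (wire ⊗ Δη))       ≈⟨ ∘-resp-≈ʳ (∘-resp-≈ˡ (⊗-wire-wire φ)) ⟩
    (μ ⊗ wire) ∘ ((φ ⊗ id 2) ∘ (wire ⊗ Δη))                ≈⟨ ∘-resp-≈ʳ (⊗-commute φ Δη) ⟨
    (μ ⊗ wire) ∘ ((wire ⊗ Δη) ∘ (φ ⊗ id 0))                ≈⟨ ∘-resp-≈ʳ (∘-resp-≈ʳ (⊗-unitʳ φ)) ⟩
    (μ ⊗ wire) ∘ ((wire ⊗ Δη) ∘ φ)                         ≈⟨ assocˡ ⟩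
    ((μ ⊗ wire) ∘ (wire ⊗ Δη)) ∘ φ                         ≈⟨ ∘-resp-≈ˡ Δ≈ ⟩
    Δ ∘ φ                                                  ∎
    where
    Δη : Hom 0 2
    Δη = Δ ∘ η
    Δ≈ : (μ ⊗ wire) ∘ (wire ⊗ Δη) ≈ Δ
    Δ≈ = Δ-via-μ frobˡ unitʳ

  comparison : Hom 1 0 → Hom 1 2 → Hom 1 1
  comparison ε Δ = (ε ⊗ wire) ∘ Δ

  comparison-phase : ∀ {μ : Hom 2 1} {Δ : Hom 1 2} (ε : Hom 1 0) →
                     (wire ⊗ μ) ∘ (Δ ⊗ wire) ≈ Δ ∘ μ →
                     μ ∘ (comparison ε Δ ⊗ wire) ≈ comparison ε Δ ∘ μ
  comparison-phase {μ} {Δ} ε frobʳ = begin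
    μ ∘ (((ε ⊗ wire) ∘ Δ) ⊗ wire)              ≈⟨ ∘-resp-≈ʳ (first-∘ (ε ⊗ wire) Δ) ⟩
    μ ∘ (((ε ⊗ wire) ⊗ wire) ∘ (Δ ⊗ wire))     ≈⟨ assocˡ ⟩
    (μ ∘ ((ε ⊗ wire) ⊗ wire)) ∘ (Δ ⊗ wire)     ≈⟨ ∘-resp-≈ˡ (∘-cong (⊗-unitˡ μ) (≈.sym (⊗-wire-wire ε))) ⟨
    ((id 0 ⊗ μ) ∘ (ε ⊗ id 2)) ∘ (Δ ⊗ wire)     ≈⟨ ∘-resp-≈ˡ (⊗-commute ε μ) ⟩
    ((ε ⊗ wire) ∘ (wire ⊗ μ)) ∘ (Δ ⊗ wire)     ≈⟨ assocʳ ⟩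
    (ε ⊗ wire) ∘ ((wire ⊗ μ) ∘ (Δ ⊗ wire))     ≈⟨ ∘-resp-≈ʳ frobʳ ⟩
    (ε ⊗ wire) ∘ (Δ ∘ μ)                       ≈⟨ assocˡ ⟩
    ((ε ⊗ wire) ∘ Δ) ∘ μ                       ∎

  ∘-comparison : ∀ {n} (ε : Hom 1 0) (Δ : Hom 1 2) (g : Hom 1 n) →
                 g ∘ comparison ε Δ ≈ (ε ⊗ id n) ∘ ((wire ⊗ g) ∘ Δ)
  ∘-comparison {n} ε Δ g = begin
    g ∘ ((ε ⊗ wire) ∘ Δ)                ≈⟨ assocˡ ⟩
    (g ∘ (ε ⊗ wire)) ∘ Δ                ≈⟨ ∘-resp-≈ˡ (∘-resp-≈ˡ (⊗-unitˡ g)) ⟨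
    ((id 0 ⊗ g) ∘ (ε ⊗ wire)) ∘ Δ       ≈⟨ ∘-resp-≈ˡ (⊗-commute ε g) ⟩
    ((ε ⊗ id n) ∘ (wire ⊗ g)) ∘ Δ       ≈⟨ assocʳ ⟩
    (ε ⊗ id n) ∘ ((wire ⊗ g) ∘ Δ)       ∎

  counit-via-comparison : ∀ {Δ₁ : Hom 1 2} {ε₁ ε₂ : Hom 1 0} →
                          (wire ⊗ ε₁) ∘ Δ₁ ≈ wire → ε₂ ≈ ε₁ ∘ comparison ε₂ Δ₁
  counit-via-comparison {Δ₁} {ε₁} {ε₂} counitʳ = begin
    ε₂                                  ≈⟨ ⊗-unitʳ ε₂ ⟨
    ε₂ ⊗ id 0                           ≈⟨ identityʳ (ε₂ ⊗ id 0) ⟨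
    (ε₂ ⊗ id 0) ∘ wire                  ≈⟨ ∘-resp-≈ʳ counitʳ ⟨
    (ε₂ ⊗ id 0) ∘ ((wire ⊗ ε₁) ∘ Δ₁)    ≈⟨ ∘-comparison ε₂ Δ₁ ε₁ ⟨
    ε₁ ∘ comparison ε₂ Δ₁               ∎

  module Comparison {μ : Hom 2 1} {η : Hom 0 1} (μ-unitʳ : μ ∘ (wire ⊗ η) ≈ wire)
                    {Δ₁ : Hom 1 2} {ε₁ : Hom 1 0} (comonoid₁ : IsCocommComonoid P Δ₁ ε₁)
                    (frobenius₁ : IsFrobeniusLaw P μ Δ₁)
                    {Δ₂ : Hom 1 2} {ε₂ : Hom 1 0} (comonoid₂ : IsComonoid P Δ₂ ε₂)
                    (frobenius₂ : IsFrobeniusLaw P μ Δ₂) where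
    open IsCocommComonoid comonoid₁ using (Δ-counitʳ; Δ-cocomm)
    open IsComonoid comonoid₂ using (Δ-counitˡ)
    module F₁ = IsFrobeniusLaw frobenius₁
    module F₂ = IsFrobeniusLaw frobenius₂

    φ : Hom 1 1
    φ = comparison ε₁ Δ₂

    φ⁻¹ : Hom 1 1
    φ⁻¹ = comparison ε₂ Δ₁

    φ-phase : μ ∘ (φ ⊗ wire) ≈ φ ∘ μ
    φ-phase = comparison-phase ε₁ F₂.frobʳ

    Δ₁-phaseʳ : (wire ⊗ φ) ∘ Δ₁ ≈ Δ₁ ∘ φ
    Δ₁-phaseʳ = Δ-phaseʳ Δ-cocomm (Δ-phaseˡ F₁.frobˡ μ-unitʳ φ-phase)

    Δ-interchange : (wire ⊗ Δ₂) ∘ Δ₁ ≈ (Δ₁ ⊗ wire) ∘ Δ₂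
    Δ-interchange = ≈.trans left (≈.sym right)
      where
      Δη : Hom 0 2
      Δη = Δ₂ ∘ η
      Δ₂≈ : (μ ⊗ wire) ∘ (wire ⊗ Δη) ≈ Δ₂
      Δ₂≈ = Δ-via-μ F₂.frobˡ μ-unitʳ

      left : (wire ⊗ Δ₂) ∘ Δ₁ ≈ (wire ⊗ (μ ⊗ wire)) ∘ (Δ₁ ⊗ Δη)
      left = begin
        (wire ⊗ Δ₂) ∘ Δ₁                                       ≈⟨ ∘-resp-≈ˡ (⊗-cong ≈.refl Δ₂≈) ⟨
        (wire ⊗ ((μ ⊗ wire) ∘ (wire ⊗ Δη))) ∘ Δ₁               ≈⟨ ∘-resp-≈ˡ (second-∘ (μ ⊗ wire) (wire ⊗ Δη)) ⟩
        ((wire ⊗ (μ ⊗ wire)) ∘ (wire ⊗ (wire ⊗ Δη))) ∘ Δ₁      ≈⟨ assocʳ ⟩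
        (wire ⊗ (μ ⊗ wire)) ∘ ((wire ⊗ (wire ⊗ Δη)) ∘ Δ₁)      ≈⟨ ∘-resp-≈ʳ (∘-resp-≈ˡ (wire-wire-⊗ Δη)) ⟨
        (wire ⊗ (μ ⊗ wire)) ∘ ((id 2 ⊗ Δη) ∘ Δ₁)               ≈⟨ ∘-resp-≈ʳ (∘-resp-≈ʳ (⊗-unitʳ Δ₁)) ⟨
        (wire ⊗ (μ ⊗ wire)) ∘ ((id 2 ⊗ Δη) ∘ (Δ₁ ⊗ id 0))      ≈⟨ ∘-resp-≈ʳ (serialize₂₁ Δ₁ Δη) ⟨
        (wire ⊗ (μ ⊗ wire)) ∘ (Δ₁ ⊗ Δη)                        ∎

      right : (Δ₁ ⊗ wire) ∘ Δ₂ ≈ (wire ⊗ (μ ⊗ wire)) ∘ (Δ₁ ⊗ Δη)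
      right = begin
        (Δ₁ ⊗ wire) ∘ Δ₂                                               ≈⟨ ∘-resp-≈ʳ Δ₂≈ ⟨
        (Δ₁ ⊗ wire) ∘ ((μ ⊗ wire) ∘ (wire ⊗ Δη))                       ≈⟨ assocˡ ⟩
        ((Δ₁ ⊗ wire) ∘ (μ ⊗ wire)) ∘ (wire ⊗ Δη)                       ≈⟨ ∘-resp-≈ˡ (first-∘ Δ₁ μ) ⟨
        ((Δ₁ ∘ μ) ⊗ wire) ∘ (wire ⊗ Δη)                                ≈⟨ ∘-resp-≈ˡ (⊗-cong F₁.frobʳ ≈.refl) ⟨
        (((wire ⊗ μ) ∘ (Δ₁ ⊗ wire)) ⊗ wire) ∘ (wire ⊗ Δη)              ≈⟨ ∘-resp-≈ˡ (first-∘ (wire ⊗ μ) (Δ₁ ⊗ wire)) ⟩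
        (((wire ⊗ μ) ⊗ wire) ∘ ((Δ₁ ⊗ wire) ⊗ wire)) ∘ (wire ⊗ Δη)     ≈⟨ assocʳ ⟩
        ((wire ⊗ μ) ⊗ wire) ∘ (((Δ₁ ⊗ wire) ⊗ wire) ∘ (wire ⊗ Δη))     ≈⟨ ∘-cong (⊗-assoc wire μ wire) (∘-resp-≈ˡ (⊗-wire-wire Δ₁)) ⟩
        (wire ⊗ (μ ⊗ wire)) ∘ ((Δ₁ ⊗ id 2) ∘ (wire ⊗ Δη))              ≈⟨ ∘-resp-≈ʳ (serialize₁₂ Δ₁ Δη) ⟨
        (wire ⊗ (μ ⊗ wire)) ∘ (Δ₁ ⊗ Δη)                                ∎

    Δ₂≈Δ₁∘φ : Δ₂ ≈ Δ₁ ∘ φ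
    Δ₂≈Δ₁∘φ = begin
      Δ₂                                                  ≈⟨ identityˡ Δ₂ ⟨
      id 2 ∘ Δ₂                                           ≈⟨ ∘-resp-≈ˡ (⊗-id 1 1) ⟨
      (wire ⊗ wire) ∘ Δ₂                                  ≈⟨ ∘-resp-≈ˡ (⊗-cong Δ-counitʳ ≈.refl) ⟨
      (((wire ⊗ ε₁) ∘ Δ₁) ⊗ wire) ∘ Δ₂                    ≈⟨ ∘-resp-≈ˡ (first-∘ (wire ⊗ ε₁) Δ₁) ⟩
      (((wire ⊗ ε₁) ⊗ wire) ∘ (Δ₁ ⊗ wire)) ∘ Δ₂           ≈⟨ assocʳ ⟩
      ((wire ⊗ ε₁) ⊗ wire) ∘ ((Δ₁ ⊗ wire) ∘ Δ₂)           ≈⟨ ∘-cong (⊗-assoc wire ε₁ wire) (≈.sym Δ-interchange) ⟩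
      (wire ⊗ (ε₁ ⊗ wire)) ∘ ((wire ⊗ Δ₂) ∘ Δ₁)           ≈⟨ assocˡ ⟩
      ((wire ⊗ (ε₁ ⊗ wire)) ∘ (wire ⊗ Δ₂)) ∘ Δ₁           ≈⟨ ∘-resp-≈ˡ (second-∘ (ε₁ ⊗ wire) Δ₂) ⟨
      (wire ⊗ φ) ∘ Δ₁                                     ≈⟨ Δ₁-phaseʳ ⟩
      Δ₁ ∘ φ                                              ∎

    ε₂≈ε₁∘φ⁻¹ : ε₂ ≈ ε₁ ∘ φ⁻¹
    ε₂≈ε₁∘φ⁻¹ = counit-via-comparison Δ-counitʳ

    φ∘φ⁻¹ : φ ∘ φ⁻¹ ≈ wire
    φ∘φ⁻¹ = begin
      φ ∘ φ⁻¹                         ≈⟨ ∘-comparison ε₂ Δ₁ φ ⟩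
      (ε₂ ⊗ wire) ∘ ((wire ⊗ φ) ∘ Δ₁) ≈⟨ ∘-resp-≈ʳ (≈.trans Δ₁-phaseʳ (≈.sym Δ₂≈Δ₁∘φ)) ⟩
      (ε₂ ⊗ wire) ∘ Δ₂                ≈⟨ Δ-counitˡ ⟩
      wire                            ∎

  module PhaseShift {μ : Hom 2 1} {η : Hom 0 1} (μ-unitʳ : μ ∘ (wire ⊗ η) ≈ wire)
                    (μ-comm : μ ∘ swap ≈ μ)
                    {Δ : Hom 1 2} {ε : Hom 1 0} (comonoid : IsCocommComonoid P Δ ε)
                    (frobenius : IsFrobeniusLaw P μ Δ)
                    {φ ψ : Hom 1 1} (ψ∘φ : ψ ∘ φ ≈ wire) (phase : μ ∘ (φ ⊗ wire) ≈ φ ∘ μ) where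
    open IsCocommComonoid comonoid
    open IsFrobeniusLaw frobenius

    phaseˡ : (φ ⊗ wire) ∘ Δ ≈ Δ ∘ φ
    phaseˡ = Δ-phaseˡ frobˡ μ-unitʳ phase

    phaseʳ : (wire ⊗ φ) ∘ Δ ≈ Δ ∘ φ
    phaseʳ = Δ-phaseʳ Δ-cocomm phaseˡ

    coassoc : ((Δ ∘ φ) ⊗ wire) ∘ (Δ ∘ φ) ≈ (wire ⊗ (Δ ∘ φ)) ∘ (Δ ∘ φ)
    coassoc = begin
      ((Δ ∘ φ) ⊗ wire) ∘ (Δ ∘ φ)                  ≈⟨ ∘-resp-≈ˡ (first-∘ Δ φ) ⟩
      ((Δ ⊗ wire) ∘ (φ ⊗ wire)) ∘ (Δ ∘ φ)         ≈⟨ assocʳ ⟩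
      (Δ ⊗ wire) ∘ ((φ ⊗ wire) ∘ (Δ ∘ φ))         ≈⟨ ∘-resp-≈ʳ (≈.trans assocˡ (∘-resp-≈ˡ phaseˡ)) ⟩
      (Δ ⊗ wire) ∘ ((Δ ∘ φ) ∘ φ)                  ≈⟨ ≈.trans (∘-resp-≈ʳ assocʳ) assocˡ ⟩
      ((Δ ⊗ wire) ∘ Δ) ∘ (φ ∘ φ)                  ≈⟨ ∘-resp-≈ˡ Δ-coassoc ⟩
      ((wire ⊗ Δ) ∘ Δ) ∘ (φ ∘ φ)                  ≈⟨ ≈.trans assocʳ (∘-resp-≈ʳ assocˡ) ⟩
      (wire ⊗ Δ) ∘ ((Δ ∘ φ) ∘ φ)                  ≈⟨ ∘-resp-≈ʳ (≈.trans assocˡ (∘-resp-≈ˡ phaseʳ)) ⟨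
      (wire ⊗ Δ) ∘ ((wire ⊗ φ) ∘ (Δ ∘ φ))         ≈⟨ assocˡ ⟩
      ((wire ⊗ Δ) ∘ (wire ⊗ φ)) ∘ (Δ ∘ φ)         ≈⟨ ∘-resp-≈ˡ (second-∘ Δ φ) ⟨
      (wire ⊗ (Δ ∘ φ)) ∘ (Δ ∘ φ)                  ∎

    counitˡ : ((ε ∘ ψ) ⊗ wire) ∘ (Δ ∘ φ) ≈ wire
    counitˡ = begin
      ((ε ∘ ψ) ⊗ wire) ∘ (Δ ∘ φ)                  ≈⟨ ∘-cong (≈.sym (first-∘ ε ψ)) phaseˡ ⟨
      ((ε ⊗ wire) ∘ (ψ ⊗ wire)) ∘ ((φ ⊗ wire) ∘ Δ) ≈⟨ ≈.trans assocʳ (∘-resp-≈ʳ assocˡ) ⟩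
      (ε ⊗ wire) ∘ (((ψ ⊗ wire) ∘ (φ ⊗ wire)) ∘ Δ) ≈⟨ ∘-resp-≈ʳ (∘-resp-≈ˡ (first-∘ ψ φ)) ⟨
      (ε ⊗ wire) ∘ (((ψ ∘ φ) ⊗ wire) ∘ Δ)         ≈⟨ ∘-resp-≈ʳ (∘-resp-≈ˡ (≈.trans (⊗-cong ψ∘φ ≈.refl) (⊗-id 1 1))) ⟩
      (ε ⊗ wire) ∘ (id 2 ∘ Δ)                     ≈⟨ ∘-resp-≈ʳ (identityˡ Δ) ⟩
      (ε ⊗ wire) ∘ Δ                              ≈⟨ Δ-counitˡ ⟩
      wire                                        ∎

    counitʳ : (wire ⊗ (ε ∘ ψ)) ∘ (Δ ∘ φ) ≈ wire
    counitʳ = begin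
      (wire ⊗ (ε ∘ ψ)) ∘ (Δ ∘ φ)                  ≈⟨ ∘-cong (≈.sym (second-∘ ε ψ)) phaseʳ ⟨
      ((wire ⊗ ε) ∘ (wire ⊗ ψ)) ∘ ((wire ⊗ φ) ∘ Δ) ≈⟨ ≈.trans assocʳ (∘-resp-≈ʳ assocˡ) ⟩
      (wire ⊗ ε) ∘ (((wire ⊗ ψ) ∘ (wire ⊗ φ)) ∘ Δ) ≈⟨ ∘-resp-≈ʳ (∘-resp-≈ˡ (second-∘ ψ φ)) ⟨
      (wire ⊗ ε) ∘ ((wire ⊗ (ψ ∘ φ)) ∘ Δ)         ≈⟨ ∘-resp-≈ʳ (∘-resp-≈ˡ (≈.trans (⊗-cong ≈.refl ψ∘φ) (⊗-id 1 1))) ⟩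
      (wire ⊗ ε) ∘ (id 2 ∘ Δ)                     ≈⟨ ∘-resp-≈ʳ (identityˡ Δ) ⟩
      (wire ⊗ ε) ∘ Δ                              ≈⟨ Δ-counitʳ ⟩
      wire                                        ∎

    isCocommComonoid : IsCocommComonoid P (Δ ∘ φ) (ε ∘ ψ)
    isCocommComonoid = record
      { Δ-coassoc = coassoc
      ; Δ-counitˡ = counitˡ
      ; Δ-counitʳ = counitʳ
      ; Δ-cocomm  = ≈.trans assocˡ (∘-resp-≈ˡ Δ-cocomm)
      }

    isFrobeniusLaw : IsFrobeniusLaw P μ (Δ ∘ φ)
    isFrobeniusLaw = record
      { frobˡ = begin
          (μ ⊗ wire) ∘ (wire ⊗ (Δ ∘ φ))           ≈⟨ ≈.trans (∘-resp-≈ʳ (second-∘ Δ φ)) assocˡ ⟩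
          ((μ ⊗ wire) ∘ (wire ⊗ Δ)) ∘ (wire ⊗ φ)  ≈⟨ ≈.trans (∘-resp-≈ˡ frobˡ) assocʳ ⟩
          Δ ∘ (μ ∘ (wire ⊗ φ))                    ≈⟨ ≈.trans (∘-resp-≈ʳ (μ-phaseʳ μ-comm phase)) assocˡ ⟩
          (Δ ∘ φ) ∘ μ                             ∎
      ; frobʳ = begin
          (wire ⊗ μ) ∘ ((Δ ∘ φ) ⊗ wire)           ≈⟨ ≈.trans (∘-resp-≈ʳ (first-∘ Δ φ)) assocˡ ⟩
          ((wire ⊗ μ) ∘ (Δ ⊗ wire)) ∘ (φ ⊗ wire)  ≈⟨ ≈.trans (∘-resp-≈ˡ frobʳ) assocʳ ⟩
          Δ ∘ (μ ∘ (φ ⊗ wire))                    ≈⟨ ≈.trans (∘-resp-≈ʳ phase) assocˡ ⟩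
          (Δ ∘ φ) ∘ μ                             ∎
      }

  IsCocommComonoid-resp-≈ : ∀ {Δ Δ′ : Hom 1 2} {ε ε′ : Hom 1 0} → Δ′ ≈ Δ → ε′ ≈ ε →
                            IsCocommComonoid P Δ ε → IsCocommComonoid P Δ′ ε′
  IsCocommComonoid-resp-≈ Δ′≈Δ ε′≈ε comonoid = record
    { Δ-coassoc = ≈.trans (∘-cong (⊗-cong Δ′≈Δ ≈.refl) Δ′≈Δ)
                    (≈.trans Δ-coassoc (≈.sym (∘-cong (⊗-cong ≈.refl Δ′≈Δ) Δ′≈Δ)))
    ; Δ-counitˡ = ≈.trans (∘-cong (⊗-cong ε′≈ε ≈.refl) Δ′≈Δ) Δ-counitˡ
    ; Δ-counitʳ = ≈.trans (∘-cong (⊗-cong ≈.refl ε′≈ε) Δ′≈Δ) Δ-counitʳ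
    ; Δ-cocomm  = ≈.trans (∘-resp-≈ʳ Δ′≈Δ) (≈.trans Δ-cocomm (≈.sym Δ′≈Δ))
    }
    where open IsCocommComonoid comonoid

  IsFrobeniusLaw-resp-≈ : ∀ {μ : Hom 2 1} {Δ Δ′ : Hom 1 2} → Δ′ ≈ Δ →
                          IsFrobeniusLaw P μ Δ → IsFrobeniusLaw P μ Δ′
  IsFrobeniusLaw-resp-≈ Δ′≈Δ frobenius = record
    { frobˡ = ≈.trans (∘-resp-≈ʳ (⊗-cong ≈.refl Δ′≈Δ)) (≈.trans frobˡ (≈.sym (∘-resp-≈ˡ Δ′≈Δ)))
    ; frobʳ = ≈.trans (∘-resp-≈ʳ (⊗-cong Δ′≈Δ ≈.refl)) (≈.trans frobʳ (≈.sym (∘-resp-≈ˡ Δ′≈Δ)))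
    }
    where open IsFrobeniusLaw frobenius

  IsCocommComonoid⇒IsComonoid : ∀ {Δ : Hom 1 2} {ε : Hom 1 0} →
                                IsCocommComonoid P Δ ε → IsComonoid P Δ ε
  IsCocommComonoid⇒IsComonoid comonoid = record
    { Δ-coassoc = Δ-coassoc ; Δ-counitˡ = Δ-counitˡ ; Δ-counitʳ = Δ-counitʳ }
    where open IsCocommComonoid comonoid

  PhaseShifted : Hom 2 1 → Hom 1 2 → Hom 1 0 → Hom 1 2 → Hom 1 0 → Set (c ⊔ ℓ)
  PhaseShifted μ Δ ε Δ′ ε′ =
    Σ (Hom 1 1) (λ φ → Σ (Hom 1 1) (λ ψ → IsPhase P μ φ ψ × ((Δ′ ≈ Δ ∘ φ) × (ε′ ≈ ε ∘ ψ))))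

  module _ {μ : Hom 2 1} {η : Hom 0 1} {Δ : Hom 1 2} {ε : Hom 1 0}
           (F : IsCommFrobenius P μ η Δ ε) where
    open IsCommFrobenius F
    open IsFrobenius isFrobenius
    open IsCommMonoid isCommMonoid using (μ-unitʳ; μ-comm)

    cocommFrobenius⇒phaseShifted : ∀ {Δ′ : Hom 1 2} {ε′ : Hom 1 0} →
                                   IsCocommComonoid P Δ′ ε′ × IsFrobenius P μ η Δ′ ε′ →
                                   PhaseShifted μ Δ ε Δ′ ε′
    cocommFrobenius⇒phaseShifted (comonoid′ , frobenius′) =
      _ , _ , ((F→F′.φ∘φ⁻¹ , F′→F.φ∘φ⁻¹) , F→F′.φ-phase) , F→F′.Δ₂≈Δ₁∘φ , F→F′.ε₂≈ε₁∘φ⁻¹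
      where
      module F→F′ = Comparison μ-unitʳ isCocommComonoid frobenius
                      (IsFrobenius.isComonoid frobenius′) (IsFrobenius.frobenius frobenius′)
      module F′→F = Comparison μ-unitʳ comonoid′ (IsFrobenius.frobenius frobenius′)
                      isComonoid frobenius

    phaseShifted⇒cocommFrobenius : ∀ {Δ′ : Hom 1 2} {ε′ : Hom 1 0} →
                                   PhaseShifted μ Δ ε Δ′ ε′ →
                                   IsCocommComonoid P Δ′ ε′ × IsFrobenius P μ η Δ′ ε′
    phaseShifted⇒cocommFrobenius {Δ′} {ε′} (φ , ψ , ((_ , ψ∘φ) , phase) , Δ′≈ , ε′≈) =
      comonoid′ , record
        { isMonoid   = isMonoid
        ; isComonoid = IsCocommComonoid⇒IsComonoid comonoid′
        ; frobenius  = IsFrobeniusLaw-resp-≈ Δ′≈ Shift.isFrobeniusLaw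
        }
      where
      module Shift = PhaseShift μ-unitʳ μ-comm isCocommComonoid frobenius ψ∘φ phase
      comonoid′ : IsCocommComonoid P Δ′ ε′
      comonoid′ = IsCocommComonoid-resp-≈ Δ′≈ ε′≈ Shift.isCocommComonoid

mainTheorem5 : ∀ {c ℓ} (P : Prop c ℓ) →
    let open Prop P in
    (μ : Hom 2 1) (η : Hom 0 1) (Δ : Hom 1 2) (ε : Hom 1 0) →
    IsCommFrobenius P μ η Δ ε →
    (Δ′ : Hom 1 2) (ε′ : Hom 1 0) →
    (IsCocommComonoid P Δ′ ε′ × IsFrobenius P μ η Δ′ ε′)
      ⇔ Σ (Hom 1 1) (λ φ → Σ (Hom 1 1) (λ ψ →
          IsPhase P μ φ ψ × ((Δ′ ≈ Δ ∘ φ) × (ε′ ≈ ε ∘ ψ))))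
mainTheorem5 P μ η Δ ε F Δ′ ε′ =
  mk⇔ (cocommFrobenius⇒phaseShifted F) (phaseShifted⇒cocommFrobenius F)
  where open FrobeniusPhases P
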